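{- Let $\mathbf A,\mathbf B$ be finite algebras in a common signature, $\rho\in\operatorname{Con}(\mathbf A)\setminus\{1_A\}$, $\sigma\in\operatorname{Con}(\mathbf B)\setminus\{1_B\}$, and let $T$ be a bridge from $(\mathbf A,\rho)$ to $(\mathbf B,\sigma)$. Then for every $L'\in\operatorname{Cov}(\rho)$ with $L'\subseteq\operatorname{pr}_{1,2}(T)$ there exists a compact bridge $T'\subseteq T$ from $(\mathbf A,\rho)$ to $(\mathbf B,\sigma)$ with $\operatorname{pr}_{1,2}(T')=L'$ and $\operatorname{tr}(T')=\operatorname{tr}(T)$.
   Context: A bridge from $(\mathbf A,\rho)$ to $(\mathbf B,\sigma)$ is a subuniverse $T\le\mathbf A\times\mathbf A\times\mathbf B\times\mathbf B$ such that (B0*) $T$ is closed under replacing its first or second coordinate by a $\rho$-related element and its third or fourth coordinate by a $\sigma$-related element; (B1*) $\rho\subsetneq\operatorname{pr}_{1,2}(T)$ and $\sigma\subsetneq\operatorname{pr}_{3,4}(T)$; (B2*) for all $(a_1,a_2,b_1,b_2)\in T$, $(a_1,a_2)\in\rho\iff(b_1,b_2)\in\sigma$. Its trace is $\operatorname{tr}(T)=\{(a,b):(a,a,b,b)\in T\}$. A subuniverse $R\le\mathbf A^2$ is $\rho$-saturated if $R=\rho\circ R\circ\rho$; $\operatorname{Cov}(\rho)$ is the set of minimal (under inclusion) $\rho$-saturated subuniverses of $\mathbf A^2$ properly containing $\rho$. A bridge is compact if $\operatorname{pr}_{1,2}(T)\in\operatorname{Cov}(\rho)$ and $\operatorname{pr}_{3,4}(T)\in\operatorname{Cov}(\sigma)$.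 -}

module Defs where

open import Data.Nat using (ℕ)
open import Data.Fin using (Fin)
open import Data.Product using (Σ; ∃; _×_; _,_)
open import Function.Bundles using (_↔_)
open import Relation.Nullary using (¬_)
open import Relation.Binary.PropositionalEquality using (_≡_)

record Signature : Set₁ where
  field
    Op    : Set
    arity : Op → ℕ

module _ (S : Signature) where
  open Signature S

  record Algebra : Set₁ where
    field
      Carrier : Set
      op      : (f : Op) → (Fin (arity f) → Carrier) → Carrier

open Algebra public

Finite : {S : Signature} → Algebra S → Set
Finite A = Σ ℕ λ n → Carrier A ↔ Fin n

-- Binary relations on an algebra (as predicates) and 4-ary relations on A×A×B×B.
-- (wrapped in records so that the algebra is inferable from the relation)
record Rel₂ {S : Signature} (A : Algebra S) : Set₁ where
  constructor rel₂
  field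
    holds₂ : Carrier A → Carrier A → Set

record Rel₄ {S : Signature} (A B : Algebra S) : Set₁ where
  constructor rel₄
  field
    holds₄ : Carrier A → Carrier A → Carrier B → Carrier B → Set

open Rel₂ public
open Rel₄ public

module _ {S : Signature} where
  open Signature S

  _⊆₂_ : {A : Algebra S} → Rel₂ A → Rel₂ A → Set
  R ⊆₂ R' = ∀ x y → holds₂ R x y → holds₂ R' x y

  _≐₂_ : {A : Algebra S} → Rel₂ A → Rel₂ A → Set
  R ≐₂ R' = (R ⊆₂ R') × (R' ⊆₂ R)

  _⊊₂_ : {A : Algebra S} → Rel₂ A → Rel₂ A → Set
  R ⊊₂ R' = (R ⊆₂ R') × ¬ (R' ⊆₂ R)

  _⊆₄_ : {A B : Algebra S} → Rel₄ A B → Rel₄ A B → Set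
  T ⊆₄ T' = ∀ a₁ a₂ b₁ b₂ → holds₄ T a₁ a₂ b₁ b₂ → holds₄ T' a₁ a₂ b₁ b₂

  IsSubuniverse₂ : (A : Algebra S) → Rel₂ A → Set
  IsSubuniverse₂ A R = ∀ (f : Op) (x y : Fin (arity f) → Carrier A) →
    (∀ i → holds₂ R (x i) (y i)) → holds₂ R (op A f x) (op A f y)

  IsSubuniverse₄ : (A B : Algebra S) → Rel₄ A B → Set
  IsSubuniverse₄ A B T = ∀ (f : Op) (x y : Fin (arity f) → Carrier A)
    (u v : Fin (arity f) → Carrier B) →
    (∀ i → holds₄ T (x i) (y i) (u i) (v i)) →
    holds₄ T (op A f x) (op A f y) (op B f u) (op B f v)

  record IsCongruence (A : Algebra S) (ρ : Rel₂ A) : Set where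
    field
      refl'  : ∀ x → holds₂ ρ x x
      sym'   : ∀ x y → holds₂ ρ x y → holds₂ ρ y x
      trans' : ∀ x y z → holds₂ ρ x y → holds₂ ρ y z → holds₂ ρ x z
      compat : IsSubuniverse₂ A ρ

  Total : (A : Algebra S) → Rel₂ A
  Total A = rel₂ λ x y → x ≡ x

  pr₁₂ : {A B : Algebra S} → Rel₄ A B → Rel₂ A
  pr₁₂ {B = B} T = rel₂ λ a₁ a₂ → Σ (Carrier B) λ b₁ → Σ (Carrier B) λ b₂ → holds₄ T a₁ a₂ b₁ b₂

  pr₃₄ : {A B : Algebra S} → Rel₄ A B → Rel₂ B
  pr₃₄ {A = A} T = rel₂ λ b₁ b₂ → Σ (Carrier A) λ a₁ → Σ (Carrier A) λ a₂ → holds₄ T a₁ a₂ b₁ b₂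

  tr : {A B : Algebra S} → Rel₄ A B → Carrier A → Carrier B → Set
  tr T a b = holds₄ T a a b b

  _∘₃_∘₃_ : {A : Algebra S} → Rel₂ A → Rel₂ A → Rel₂ A → Rel₂ A
  _∘₃_∘₃_ {A} ρ R ρ' = rel₂ λ x y →
    Σ (Carrier A) λ u → Σ (Carrier A) λ v → holds₂ ρ x u × holds₂ R u v × holds₂ ρ' v y

  IsSaturated : (A : Algebra S) → Rel₂ A → Rel₂ A → Set
  IsSaturated A ρ R = IsSubuniverse₂ A R × (R ≐₂ (ρ ∘₃ R ∘₃ ρ))

  InCov : (A : Algebra S) → Rel₂ A → Rel₂ A → Set₁
  InCov A ρ L =
    IsSaturated A ρ L × (ρ ⊊₂ L) ×
    (∀ (R : Rel₂ A) → IsSaturated A ρ R → ρ ⊊₂ R → R ⊆₂ L → L ⊆₂ R)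

  record IsBridge (A B : Algebra S) (ρ : Rel₂ A) (σ : Rel₂ B) (T : Rel₄ A B) : Set where
    field
      subuniverse : IsSubuniverse₄ A B T
      closed₁ : ∀ a₁ a₂ b₁ b₂ a → holds₄ T a₁ a₂ b₁ b₂ → holds₂ ρ a₁ a → holds₄ T a a₂ b₁ b₂
      closed₂ : ∀ a₁ a₂ b₁ b₂ a → holds₄ T a₁ a₂ b₁ b₂ → holds₂ ρ a₂ a → holds₄ T a₁ a b₁ b₂
      closed₃ : ∀ a₁ a₂ b₁ b₂ b → holds₄ T a₁ a₂ b₁ b₂ → holds₂ σ b₁ b → holds₄ T a₁ a₂ b b₂
      closed₄ : ∀ a₁ a₂ b₁ b₂ b → holds₄ T a₁ a₂ b₁ b₂ → holds₂ σ b₂ b → holds₄ T a₁ a₂ b₁ b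
      strict₁₂ : ρ ⊊₂ pr₁₂ T
      strict₃₄ : σ ⊊₂ pr₃₄ T
      iff→ : ∀ a₁ a₂ b₁ b₂ → holds₄ T a₁ a₂ b₁ b₂ → holds₂ ρ a₁ a₂ → holds₂ σ b₁ b₂
      iff← : ∀ a₁ a₂ b₁ b₂ → holds₄ T a₁ a₂ b₁ b₂ → holds₂ σ b₁ b₂ → holds₂ ρ a₁ a₂

  IsCompactBridge : (A B : Algebra S) (ρ : Rel₂ A) (σ : Rel₂ B) (T : Rel₄ A B) → Set₁
  IsCompactBridge A B ρ σ T =
    IsBridge A B ρ σ T × InCov A ρ (pr₁₂ T) × InCov B σ (pr₃₄ T)

-- Write T' = T ∩ (L' × M), where M is a cover of σ generated by a single
-- pair q ∉ σ of pr₃₄ T lying over L'.  Choosing q so that the σ-saturated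
-- subuniverse ⟨q⟩ generated by σ ∪ {q} is as small as possible makes every
-- pair of ⟨q⟩ ∖ σ generate q back, so M = ⟨q⟩ is a cover; minimality of L'
-- then forces pr₁₂ T' = L', and the trace survives because diagonal pairs lie
-- in ρ ⊆ L' and σ ⊆ M.
--
-- The search for q is classical.  It is made constructive by the observation
-- that minimality of L' with respect to the relations ρ ∪ (L' ∩ Q), for an
-- arbitrary proposition Q, yields excluded middle as soon as a pair of
-- L' ∖ ρ is known; such a pair exists up to double negation, which suffices
-- for the negative conditions ρ ≠ pr₁₂ T' and σ ≠ pr₃₄ T'.
module Submission where

open import Axiom.DoubleNegationElimination using (DoubleNegationElimination; dne⇒em)
open import Axiom.ExcludedMiddle using (ExcludedMiddle)
open import Data.Bool.Properties using (T-≡)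
open import Data.Fin using (Fin; zero; suc; toℕ)
open import Data.Fin.Properties using (*↔×; toℕ-injective)
open import Data.Fin.Subset using (Subset; _∈_; _⊂_; ∣_∣)
open import Data.Fin.Subset.Properties using (p⊂q⇒∣p∣<∣q∣)
open import Data.Nat using (ℕ; zero; suc; _*_; _≤_; _<_)
open import Data.Nat.Induction using (<-wellFounded)
open import Data.Nat.Properties using (≮⇒≥; ≤-antisym; <⇒≱)
open import Data.Product using (Σ; _×_; _,_; proj₁; proj₂; swap)
open import Data.Product.Function.NonDependent.Propositional using (_×-↔_)
open import Data.Sum using (_⊎_; inj₁; inj₂)
open import Data.Vec using (tabulate)
open import Data.Vec.Properties using (lookup∘tabulate; []=⇒lookup; lookup⇒[]=)
open import Function.Bundles using (_↔_; Inverse; Equivalence)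
open import Function.Properties.Inverse using (↔-sym; ↔-trans)
open import Induction.WellFounded using (Acc; acc)
open import Level using (0ℓ)
open import Relation.Binary.PropositionalEquality using (_≡_; refl; sym; trans; cong; subst)
open import Relation.Nullary using (¬_; yes; no; contradiction)
open import Relation.Nullary.Decidable using (isYes; toWitness; fromWitness)

open import Defs

all⊎any : ∀ {k} {P Q : Fin k → Set} → (∀ i → P i ⊎ Q i) → (∀ i → P i) ⊎ Σ (Fin k) Q
all⊎any {zero}  h = inj₁ λ ()
all⊎any {suc k} h with h zero | all⊎any (λ i → h (suc i))
... | inj₂ q | _            = inj₂ (zero , q)
... | inj₁ _ | inj₂ (i , q) = inj₂ (suc i , q)
... | inj₁ p | inj₁ ps      = inj₁ λ { zero → p ; (suc i) → ps i }

module _ (em : ExcludedMiddle 0ℓ) {X : Set} (μ : X → ℕ) {P : X → Set} where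

  argmin : Σ X P → Σ X λ x → P x × (∀ y → P y → μ x ≤ μ y)
  argmin (x , px) = descend x px (<-wellFounded (μ x))
    where
    descend : ∀ x → P x → Acc _<_ (μ x) → Σ X λ x → P x × (∀ y → P y → μ x ≤ μ y)
    descend x px (acc smaller) with em {Σ X λ y → P y × μ y < μ x}
    ... | yes (y , py , μy<μx) = descend y py (smaller μy<μx)
    ... | no  none             = x , px , λ y py → ≮⇒≥ λ μy<μx → none (y , py , μy<μx)

module Extent {X : Set} {N : ℕ} (enum : X ↔ Fin N) (em : ExcludedMiddle 0ℓ) where
  open Inverse enum using (to; from; strictlyInverseʳ)

  extent : (X → Set) → Subset N
  extent P = tabulate λ i → isYes (em {P (from i)})

  ∈-extent⁺ : ∀ {P i} → P (from i) → i ∈ extent P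
  ∈-extent⁺ {P} {i} p = lookup⇒[]= i (extent P)
    (trans (lookup∘tabulate _ i) (Equivalence.to T-≡ (fromWitness p)))

  ∈-extent⁻ : ∀ {P i} → i ∈ extent P → P (from i)
  ∈-extent⁻ {P} {i} i∈P = toWitness
    (Equivalence.from T-≡ (trans (sym (lookup∘tabulate _ i)) ([]=⇒lookup i∈P)))

  extent-⊂ : ∀ {P Q : X → Set} {x} → (∀ {y} → P y → Q y) → Q x → ¬ P x → extent P ⊂ extent Q
  extent-⊂ {P} {Q} {x} P⊆Q qx ¬px =
    (λ i∈P → ∈-extent⁺ {Q} (P⊆Q (∈-extent⁻ {P} i∈P))) ,
    to x , ∈-extent⁺ {Q} (subst Q (sym (strictlyInverseʳ x)) qx) ,
    λ x∈P → ¬px (subst P (strictlyInverseʳ x) (∈-extent⁻ {P} x∈P))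

module _ {S : Signature} where
  open Signature S

  infix 4 _∋₂_
  _∋₂_ : {A : Algebra S} → Rel₂ A → Carrier A × Carrier A → Set
  R ∋₂ q = holds₂ R (proj₁ q) (proj₂ q)

  Gap : {A : Algebra S} → Rel₂ A → Rel₂ A → Set
  Gap {A} ρ L = Σ (Carrier A × Carrier A) λ q → L ∋₂ q × ¬ ρ ∋₂ q

  _∪_when_ : {A : Algebra S} → Rel₂ A → Rel₂ A → Set → Rel₂ A
  ρ ∪ L when Q = rel₂ λ x y → holds₂ ρ x y ⊎ (holds₂ L x y × Q)

  module _ {A : Algebra S} {ρ : Rel₂ A} (ρc : IsCongruence A ρ) where
    open IsCongruence ρc

    saturated : {R : Rel₂ A} → IsSubuniverse₂ A R → (ρ ∘₃ R ∘₃ ρ) ⊆₂ R → IsSaturated A ρ R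
    saturated sub back = sub , (λ x y r → x , y , refl' x , r , refl' y) , back

    module _ {R : Rel₂ A} (Rsat : IsSaturated A ρ R) where

      saturated-closedˡ : ∀ {x x' y} → holds₂ R x y → holds₂ ρ x x' → holds₂ R x' y
      saturated-closedˡ {x} {x'} {y} r xρx' = proj₂ (proj₂ Rsat) x' y (x , y , sym' x x' xρx' , r , refl' y)

      saturated-closedʳ : ∀ {x y y'} → holds₂ R x y → holds₂ ρ y y' → holds₂ R x y'
      saturated-closedʳ {x} {y} {y'} r yρy' = proj₂ (proj₂ Rsat) x y' (x , y , refl' x , r , yρy')

  Total-saturated : {B : Algebra S} {σ : Rel₂ B} → IsCongruence B σ → IsSaturated B σ (Total B)
  Total-saturated σc = saturated σc (λ _ _ _ _ → refl) (λ _ _ _ → refl)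

  InCov-resp-≐ : {A : Algebra S} {ρ L L₂ : Rel₂ A} → InCov A ρ L → L ≐₂ L₂ → InCov A ρ L₂
  InCov-resp-≐ ((sub , ⊆sat , sat⊆) , (ρ⊆L , L⊈ρ) , minimal) (L⊆L₂ , L₂⊆L) =
    ( (λ f xs ys h → L⊆L₂ _ _ (sub f xs ys λ i → L₂⊆L _ _ (h i)))
    , (λ x y l₂ → let (u , v , xρu , l , vρy) = ⊆sat x y (L₂⊆L x y l₂) in u , v , xρu , L⊆L₂ u v l , vρy)
    , (λ { x y (u , v , xρu , l₂ , vρy) → L⊆L₂ x y (sat⊆ x y (u , v , xρu , L₂⊆L u v l₂ , vρy)) }) )
    , ((λ x y r → L⊆L₂ x y (ρ⊆L x y r)) , λ L₂⊆ρ → L⊈ρ λ x y l → L₂⊆ρ x y (L⊆L₂ x y l))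
    , λ R Rsat ρ⊊R R⊆L₂ x y l₂ → minimal R Rsat ρ⊊R (λ x y r → L₂⊆L x y (R⊆L₂ x y r)) x y (L₂⊆L x y l₂)

  module Cover {A : Algebra S} {ρ L : Rel₂ A} (ρc : IsCongruence A ρ) (Lcov : InCov A ρ L) where
    open IsCongruence ρc

    private
      L-sub : IsSubuniverse₂ A L
      L-sub = proj₁ (proj₁ Lcov)

      ρ⊆L : ρ ⊆₂ L
      ρ⊆L = proj₁ (proj₁ (proj₂ Lcov))

      L⊈ρ : ¬ (L ⊆₂ ρ)
      L⊈ρ = proj₂ (proj₁ (proj₂ Lcov))

      union⊆L : ∀ {Q} → (ρ ∪ L when Q) ⊆₂ L
      union⊆L x y (inj₁ r)       = ρ⊆L x y r
      union⊆L x y (inj₂ (l , _)) = l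

    union-saturated : ∀ Q → IsSaturated A ρ (ρ ∪ L when Q)
    union-saturated Q = saturated ρc sub back
      where
      sub : IsSubuniverse₂ A (ρ ∪ L when Q)
      sub f xs ys h with all⊎any h
      ... | inj₁ allρ          = inj₁ (compat f xs ys allρ)
      ... | inj₂ (_ , (_ , q)) = inj₂ (L-sub f xs ys (λ i → union⊆L _ _ (h i)) , q)

      back : (ρ ∘₃ (ρ ∪ L when Q) ∘₃ ρ) ⊆₂ (ρ ∪ L when Q)
      back x y (u , v , xρu , inj₁ uρv , vρy) = inj₁ (trans' x u y xρu (trans' u v y uρv vρy))
      back x y (u , v , xρu , inj₂ (l , q) , vρy) =
        inj₂ (proj₂ (proj₂ (proj₁ Lcov)) x y (u , v , xρu , l , vρy) , q)

    L⊆union : ∀ {Q} → ¬ ¬ Q → L ⊆₂ (ρ ∪ L when Q)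
    L⊆union {Q} ¬¬q = proj₂ (proj₂ Lcov) (ρ ∪ L when Q) (union-saturated Q)
      ((λ _ _ → inj₁) , λ union⊆ρ → ¬¬q λ q → L⊈ρ λ x y l → union⊆ρ x y (inj₂ (l , q)))
      union⊆L

    gap-dne : Gap ρ L → DoubleNegationElimination 0ℓ
    gap-dne (_ , l , ¬r) ¬¬P with L⊆union ¬¬P _ _ l
    ... | inj₁ r       = contradiction r ¬r
    ... | inj₂ (_ , p) = p

    gap-em : Gap ρ L → ExcludedMiddle 0ℓ
    gap-em w = dne⇒em (gap-dne w)

    ¬¬-gap : ¬ ¬ Gap ρ L
    ¬¬-gap ¬gap = L⊈ρ λ x y l → ρ-stable l λ r → ¬gap ((x , y) , l , r)
      where
      ρ-stable : ∀ {x y} → holds₂ L x y → ¬ ¬ holds₂ ρ x y → holds₂ ρ x y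
      ρ-stable {x} {y} l ¬¬r with L⊆union ¬¬r x y l
      ... | inj₁ r       = r
      ... | inj₂ (_ , r) = r

  data Generated {B : Algebra S} (σ : Rel₂ B) (q : Carrier B × Carrier B) : Carrier B → Carrier B → Set where
    base      : ∀ {x y} → holds₂ σ x y → Generated σ q x y
    generator : Generated σ q (proj₁ q) (proj₂ q)
    apply     : ∀ f (xs ys : Fin (arity f) → Carrier B) →
                (∀ i → Generated σ q (xs i) (ys i)) → Generated σ q (op B f xs) (op B f ys)
    saturate  : ∀ {x u v y} → holds₂ σ x u → Generated σ q u v → holds₂ σ v y → Generated σ q x y

  ⟨_∣_⟩ : {B : Algebra S} → Rel₂ B → Carrier B × Carrier B → Rel₂ B
  ⟨ σ ∣ q ⟩ = rel₂ (Generated σ q)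

  module _ {B : Algebra S} {σ : Rel₂ B} where

    generated-saturated : IsCongruence B σ → ∀ q → IsSaturated B σ ⟨ σ ∣ q ⟩
    generated-saturated σc q = saturated σc apply λ { x y (u , v , xσu , g , vσy) → saturate xσu g vσy }

    generated-least : ∀ {q R} → IsSaturated B σ R → σ ⊆₂ R → R ∋₂ q → ⟨ σ ∣ q ⟩ ⊆₂ R
    generated-least Rsat σ⊆R q∈R x y (base xσy)              = σ⊆R x y xσy
    generated-least Rsat σ⊆R q∈R x y generator               = q∈R
    generated-least Rsat σ⊆R q∈R x y (apply f xs ys gs)      =
      proj₁ Rsat f xs ys λ i → generated-least Rsat σ⊆R q∈R (xs i) (ys i) (gs i)
    generated-least Rsat σ⊆R q∈R x y (saturate {u = u} {v} xσu g vσy) =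
      proj₂ (proj₂ Rsat) x y (u , v , xσu , generated-least Rsat σ⊆R q∈R u v g , vσy)

    generated-mono : IsCongruence B σ → ∀ {q q'} → ⟨ σ ∣ q ⟩ ∋₂ q' → ⟨ σ ∣ q' ⟩ ⊆₂ ⟨ σ ∣ q ⟩
    generated-mono σc {q} q'∈q = generated-least (generated-saturated σc q) (λ _ _ → base) q'∈q

  record IsSaturated₄ (A B : Algebra S) (ρ : Rel₂ A) (σ : Rel₂ B) (T : Rel₄ A B) : Set where
    field
      subuniverse : IsSubuniverse₄ A B T
      closed₁ : ∀ a₁ a₂ b₁ b₂ a → holds₄ T a₁ a₂ b₁ b₂ → holds₂ ρ a₁ a → holds₄ T a a₂ b₁ b₂
      closed₂ : ∀ a₁ a₂ b₁ b₂ a → holds₄ T a₁ a₂ b₁ b₂ → holds₂ ρ a₂ a → holds₄ T a₁ a b₁ b₂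
      closed₃ : ∀ a₁ a₂ b₁ b₂ b → holds₄ T a₁ a₂ b₁ b₂ → holds₂ σ b₁ b → holds₄ T a₁ a₂ b b₂
      closed₄ : ∀ a₁ a₂ b₁ b₂ b → holds₄ T a₁ a₂ b₁ b₂ → holds₂ σ b₂ b → holds₄ T a₁ a₂ b₁ b

  restrict : {A B : Algebra S} → Rel₄ A B → Rel₂ A → Rel₂ B → Rel₄ A B
  restrict T L M = rel₄ λ a₁ a₂ b₁ b₂ → holds₄ T a₁ a₂ b₁ b₂ × holds₂ L a₁ a₂ × holds₂ M b₁ b₂

  module _ {A B : Algebra S} {ρ : Rel₂ A} {σ : Rel₂ B} where

    bridge⇒saturated₄ : ∀ {T} → IsBridge A B ρ σ T → IsSaturated₄ A B ρ σ T
    bridge⇒saturated₄ Tb = record { IsBridge Tb }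

    module _ (ρc : IsCongruence A ρ) (σc : IsCongruence B σ) where

      restrict-saturated₄ : ∀ {T L M} → IsSaturated₄ A B ρ σ T → IsSaturated A ρ L → IsSaturated B σ M →
                            IsSaturated₄ A B ρ σ (restrict T L M)
      restrict-saturated₄ Tsat Lsat Msat = record
        { subuniverse = λ f xs ys us vs h →
            subuniverse f xs ys us vs (λ i → proj₁ (h i)) ,
            proj₁ Lsat f xs ys (λ i → proj₁ (proj₂ (h i))) ,
            proj₁ Msat f us vs (λ i → proj₂ (proj₂ (h i)))
        ; closed₁ = λ a₁ a₂ b₁ b₂ a (t , l , m) r → closed₁ a₁ a₂ b₁ b₂ a t r , saturated-closedˡ ρc Lsat l r , m
        ; closed₂ = λ a₁ a₂ b₁ b₂ a (t , l , m) r → closed₂ a₁ a₂ b₁ b₂ a t r , saturated-closedʳ ρc Lsat l r , m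
        ; closed₃ = λ a₁ a₂ b₁ b₂ b (t , l , m) s → closed₃ a₁ a₂ b₁ b₂ b t s , l , saturated-closedˡ σc Msat m s
        ; closed₄ = λ a₁ a₂ b₁ b₂ b (t , l , m) s → closed₄ a₁ a₂ b₁ b₂ b t s , l , saturated-closedʳ σc Msat m s
        }
        where open IsSaturated₄ Tsat

      pr₁₂-saturated : ∀ {T} → IsSaturated₄ A B ρ σ T → IsSaturated A ρ (pr₁₂ T)
      pr₁₂-saturated Tsat = saturated ρc
        (λ f xs ys h → op B f (λ i → proj₁ (h i)) , op B f (λ i → proj₁ (proj₂ (h i))) ,
                        subuniverse f xs ys _ _ (λ i → proj₂ (proj₂ (h i))))
        (λ { x y (u , v , xρu , (b₁ , b₂ , t) , vρy) →
               b₁ , b₂ , closed₁ u y b₁ b₂ x (closed₂ u v b₁ b₂ y t vρy) (sym' x u xρu) })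
        where open IsSaturated₄ Tsat
              open IsCongruence ρc

      pr₃₄-saturated : ∀ {T} → IsSaturated₄ A B ρ σ T → IsSaturated B σ (pr₃₄ T)
      pr₃₄-saturated Tsat = saturated σc
        (λ f us vs h → op A f (λ i → proj₁ (h i)) , op A f (λ i → proj₁ (proj₂ (h i))) ,
                        subuniverse _ _ _ us vs (λ i → proj₂ (proj₂ (h i))))
        (λ { x y (u , v , xσu , (a₁ , a₂ , t) , vσy) →
               a₁ , a₂ , closed₃ a₁ a₂ u y x (closed₄ a₁ a₂ u v y t vσy) (sym' x u xσu) })
        where open IsSaturated₄ Tsat
              open IsCongruence σc

module Construction {S : Signature} (A B : Algebra S) (fB : Finite B)
  (ρ : Rel₂ A) (ρc : IsCongruence A ρ) (σ : Rel₂ B) (σc : IsCongruence B σ)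
  (T : Rel₄ A B) (Tb : IsBridge A B ρ σ T)
  (L' : Rel₂ A) (L'cov : InCov A ρ L') (L'⊆T : L' ⊆₂ pr₁₂ T) where

  open IsBridge Tb using (strict₁₂; strict₃₄; iff→; iff←)
  open Cover ρc L'cov using (gap-dne; gap-em; ¬¬-gap)

  Pair : Set
  Pair = Carrier B × Carrier B

  L'-saturated : IsSaturated A ρ L'
  L'-saturated = proj₁ L'cov

  ρ⊆L' : ρ ⊆₂ L'
  ρ⊆L' = proj₁ (proj₁ (proj₂ L'cov))

  M₀ : Rel₂ B
  M₀ = pr₃₄ (restrict T L' (Total B))

  M₀-saturated : IsSaturated B σ M₀
  M₀-saturated = pr₃₄-saturated ρc σc
    (restrict-saturated₄ ρc σc (bridge⇒saturated₄ Tb) L'-saturated (Total-saturated σc))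

  σ⊆M₀ : σ ⊆₂ M₀
  σ⊆M₀ x y xσy = let (a₁ , a₂ , t) = proj₁ strict₃₄ x y xσy in
    a₁ , a₂ , t , ρ⊆L' a₁ a₂ (iff← a₁ a₂ x y t xσy) , refl

  Candidate : Pair → Set
  Candidate q = M₀ ∋₂ q × ¬ σ ∋₂ q

  Good : Pair → Set
  Good q = Candidate q × (∀ q' → ⟨ σ ∣ q ⟩ ∋₂ q' → ¬ σ ∋₂ q' → ⟨ σ ∣ q' ⟩ ∋₂ q)

  generated⊆M₀ : ∀ {q} → Candidate q → ⟨ σ ∣ q ⟩ ⊆₂ M₀
  generated⊆M₀ (q∈M₀ , _) = generated-least M₀-saturated σ⊆M₀ q∈M₀

  pairs : Pair ↔ Fin (proj₁ fB * proj₁ fB)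
  pairs = ↔-trans (proj₂ fB ×-↔ proj₂ fB) (↔-sym *↔×)

  code : Pair → ℕ
  code q = toℕ (Inverse.to pairs q)

  Least : Pair → Set
  Least q = Good q × (∀ q' → Good q' → code q ≤ code q')

  least-unique : ∀ {q q'} → Least q → Least q' → q ≡ q'
  least-unique {q} {q'} (good , least) (good' , least') =
    trans (sym (strictlyInverseʳ q))
      (trans (cong from (toℕ-injective (≤-antisym (least q' good') (least' q good))))
             (strictlyInverseʳ q'))
    where open Inverse pairs using (from; strictlyInverseʳ)

  candidate-gap : ∀ {q} → Candidate q → Gap ρ L'
  candidate-gap ((a₁ , a₂ , t , l , _) , ¬σq) = (a₁ , a₂) , l , λ a₁ρa₂ → ¬σq (iff→ a₁ a₂ _ _ t a₁ρa₂)

  gap-candidate : Gap ρ L' → Σ Pair Candidate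
  gap-candidate ((x , y) , l , ¬xρy) = let (b₁ , b₂ , t) = L'⊆T x y l in
    (b₁ , b₂) , (x , y , t , l , refl) , λ b₁σb₂ → ¬xρy (iff← x y b₁ b₂ t b₁σb₂)

  -- A candidate q with ⟨q⟩ of least cardinality is good.
  gap-good : Gap ρ L' → Σ Pair Good
  gap-good w = good (argmin em size (gap-candidate w))
    where
    em : ExcludedMiddle 0ℓ
    em = gap-em w
    open Extent pairs em

    size : Pair → ℕ
    size q = ∣ extent (⟨ σ ∣ q ⟩ ∋₂_) ∣

    good : Σ Pair (λ q → Candidate q × (∀ q' → Candidate q' → size q ≤ size q')) → Σ Pair Good
    good (q , cand , smallest) = q , cand , λ q' q'∈q ¬σq' → gap-dne w λ q∉q' →
      <⇒≱ (p⊂q⇒∣p∣<∣q∣ (extent-⊂ (λ {p} → generated-mono σc q'∈q (proj₁ p) (proj₂ p)) generator q∉q'))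
          (smallest q' (generated⊆M₀ cand _ _ q'∈q , ¬σq'))

  gap-least : Gap ρ L' → Σ Pair Least
  gap-least w = argmin (gap-em w) code (gap-good w)

  ¬¬-least : ¬ ¬ Σ Pair Least
  ¬¬-least ¬least = ¬¬-gap λ w → ¬least (gap-least w)

  -- The disjunct σ gives σ ⊆ M without producing the least good pair, which
  -- exists only classically; least-unique makes the union a single ⟨q⟩.
  M : Rel₂ B
  M = rel₂ λ x y → holds₂ σ x y ⊎ Σ Pair λ q → Least q × holds₂ ⟨ σ ∣ q ⟩ x y

  σ⊆M : σ ⊆₂ M
  σ⊆M _ _ = inj₁

  least∈M : ∀ {q} → Least q → M ∋₂ q
  least∈M {q} least = inj₂ (q , least , generator)

  M⊆generated : ∀ {q} → Least q → M ⊆₂ ⟨ σ ∣ q ⟩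
  M⊆generated least x y (inj₁ xσy)             = base xσy
  M⊆generated least x y (inj₂ (q' , least' , g)) =
    subst (λ p → Generated σ p x y) (least-unique least' least) g

  M⊆M₀ : M ⊆₂ M₀
  M⊆M₀ x y (inj₁ xσy)                       = σ⊆M₀ x y xσy
  M⊆M₀ x y (inj₂ (_ , ((cand , _) , _) , g)) = generated⊆M₀ cand x y g

  M⊈σ : ¬ (M ⊆₂ σ)
  M⊈σ M⊆σ = ¬¬-least λ (q , least) → proj₂ (proj₁ (proj₁ least)) (M⊆σ _ _ (least∈M least))

  M-saturated : IsSaturated B σ M
  M-saturated = saturated σc sub back
    where
    open IsCongruence σc

    sub : IsSubuniverse₂ B M
    sub f xs ys h with all⊎any h
    ... | inj₁ allσ                = inj₁ (compat f xs ys allσ)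
    ... | inj₂ (_ , q , least , _) = inj₂ (q , least , apply f xs ys λ i → M⊆generated least _ _ (h i))

    back : (σ ∘₃ M ∘₃ σ) ⊆₂ M
    back x y (u , v , xσu , inj₁ uσv , vσy)          = inj₁ (trans' x u y xσu (trans' u v y uσv vσy))
    back x y (u , v , xσu , inj₂ (q , least , g) , vσy) = inj₂ (q , least , saturate xσu g vσy)

  -- A pair r ∈ R ∖ σ lies in ⟨q⟩, so it generates q back because q is good.
  M-minimal : ∀ R → IsSaturated B σ R → σ ⊊₂ R → R ⊆₂ M → M ⊆₂ R
  M-minimal _ _ (σ⊆R , _) _ x y (inj₁ xσy) = σ⊆R x y xσy
  M-minimal R Rsat (σ⊆R , R⊈σ) R⊆M x y (inj₂ (q , least , g)) =
    generated-least Rsat σ⊆R q∈R x y g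
    where
    dne : DoubleNegationElimination 0ℓ
    dne = gap-dne (candidate-gap (proj₁ (proj₁ least)))

    gap : Gap σ R
    gap = dne λ ¬gap → R⊈σ λ u v r → dne λ ¬uσv → ¬gap ((u , v) , r , ¬uσv)

    q∈R : R ∋₂ q
    q∈R = let (r , r∈R , ¬σr) = gap in
      generated-least Rsat σ⊆R r∈R _ _
        (proj₂ (proj₁ least) r (M⊆generated least _ _ (R⊆M _ _ r∈R)) ¬σr)

  M-cover : InCov B σ M
  M-cover = M-saturated , (σ⊆M , M⊈σ) , M-minimal

  T' : Rel₄ A B
  T' = restrict T L' M

  T'-saturated₄ : IsSaturated₄ A B ρ σ T'
  T'-saturated₄ = restrict-saturated₄ ρc σc (bridge⇒saturated₄ Tb) L'-saturated M-saturated

  M⊆pr₃₄T' : M ⊆₂ pr₃₄ T'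
  M⊆pr₃₄T' x y m = let (a₁ , a₂ , t , l , _) = M⊆M₀ x y m in a₁ , a₂ , t , l , m

  M≐pr₃₄T' : M ≐₂ pr₃₄ T'
  M≐pr₃₄T' = M⊆pr₃₄T' , λ x y (_ , _ , _ , _ , m) → m

  T'-strict₁₂ : ρ ⊊₂ pr₁₂ T'
  T'-strict₁₂ =
    (λ x y xρy → let (b₁ , b₂ , t) = proj₁ strict₁₂ x y xρy in
       b₁ , b₂ , t , ρ⊆L' x y xρy , σ⊆M b₁ b₂ (iff→ x y b₁ b₂ t xρy)) ,
    λ pr₁₂⊆ρ → M⊈σ λ x y m → let (a₁ , a₂ , t , l , _) = M⊆M₀ x y m in
       iff→ a₁ a₂ x y t (pr₁₂⊆ρ a₁ a₂ (x , y , t , l , m))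

  T'-strict₃₄ : σ ⊊₂ pr₃₄ T'
  T'-strict₃₄ = (λ x y xσy → M⊆pr₃₄T' x y (σ⊆M x y xσy)) ,
    λ pr₃₄⊆σ → M⊈σ λ x y m → pr₃₄⊆σ x y (M⊆pr₃₄T' x y m)

  T'-bridge : IsBridge A B ρ σ T'
  T'-bridge = record
    { IsSaturated₄ T'-saturated₄
    ; strict₁₂ = T'-strict₁₂
    ; strict₃₄ = T'-strict₃₄
    ; iff→ = λ a₁ a₂ b₁ b₂ (t , _) → iff→ a₁ a₂ b₁ b₂ t
    ; iff← = λ a₁ a₂ b₁ b₂ (t , _) → iff← a₁ a₂ b₁ b₂ t
    }

  pr₁₂T'≐L' : pr₁₂ T' ≐₂ L'
  pr₁₂T'≐L' = pr₁₂T'⊆L' ,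
    proj₂ (proj₂ L'cov) (pr₁₂ T') (pr₁₂-saturated ρc σc T'-saturated₄) T'-strict₁₂ pr₁₂T'⊆L'
    where
    pr₁₂T'⊆L' : pr₁₂ T' ⊆₂ L'
    pr₁₂T'⊆L' x y (_ , _ , _ , l , _) = l

lemma4p8 : {S : Signature} (A B : Algebra S) → Finite A → Finite B →
    (ρ : Rel₂ A) → IsCongruence A ρ → ¬ (Total A ⊆₂ ρ) →
    (σ : Rel₂ B) → IsCongruence B σ → ¬ (Total B ⊆₂ σ) →
    (T : Rel₄ A B) → IsBridge A B ρ σ T →
    (L' : Rel₂ A) → InCov A ρ L' → L' ⊆₂ pr₁₂ T →
    Σ (Rel₄ A B) λ T' → (T' ⊆₄ T) × IsCompactBridge A B ρ σ T' ×
      (pr₁₂ T' ≐₂ L') × ((∀ a b → tr T' a b → tr T a b) × (∀ a b → tr T a b → tr T' a b))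
lemma4p8 A B _ fB ρ ρc _ σ σc _ T Tb L' L'cov L'⊆T =
  T' , (λ _ _ _ _ → proj₁) ,
  (T'-bridge , InCov-resp-≐ L'cov (swap pr₁₂T'≐L') , InCov-resp-≐ M-cover M≐pr₃₄T') ,
  pr₁₂T'≐L' , (λ _ _ → proj₁) , λ a b t → t , ρ⊆L' a a (IsCongruence.refl' ρc a) , σ⊆M b b (IsCongruence.refl' σc b)
  where open Construction A B fB ρ ρc σ σc T Tb L' L'cov L'⊆T
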